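{- Let $m \ge 2$ and let $G_{m,2}=S_m \Box P_2$ be the stacked-book graph. Then $im(G_{m,2})=m-1$.
   Context: $S_m$ is the star graph with one central vertex and $m-1$ leaves ($m$ vertices in total); $P_n$ is the path on $n$ vertices. The stacked-book graph $G_{m,n}=S_m\Box P_n$ is the Cartesian product: it consists of $n$ copies $S_m(1),\dots,S_m(n)$ of $S_m$, and for each $i\in[1,n-1]$ each vertex of $S_m(i)$ is joined to the corresponding vertex of $S_m(i+1)$. An induced matching of a graph $G$ is a set $M$ of edges such that no two edges of $M$ share an endpoint and no edge of $G$ joins an endpoint of one edge of $M$ to an endpoint of another edge of $M$; $im(G)$ is the maximum size of an induced matching of $G$. -}

module Defs where

open import Data.Nat using (ℕ; suc; zero)
open import Data.Fin using (Fin; toℕ)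
open import Data.Product using (_×_; _,_; proj₁; proj₂; Σ)
open import Data.Sum using (_⊎_)
open import Data.List using (List; length; lookup)
open import Relation.Binary.PropositionalEquality using (_≡_)
open import Relation.Nullary using (¬_)

record Graph : Set₁ where
  field
    V   : Set
    Adj : V → V → Set
open Graph public

-- Star S_m: vertices Fin m, the centre is the vertex with index 0,
-- every other vertex is a leaf joined to the centre only.
StarAdj : (m : ℕ) → Fin m → Fin m → Set
StarAdj m a b = (toℕ a ≡ 0 × ¬ (toℕ b ≡ 0)) ⊎ (¬ (toℕ a ≡ 0) × toℕ b ≡ 0)

PathAdj : (n : ℕ) → Fin n → Fin n → Set
PathAdj n i j = (suc (toℕ i) ≡ toℕ j) ⊎ (suc (toℕ j) ≡ toℕ i)

StackedBook : ℕ → ℕ → Graph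
StackedBook m n = record
  { V   = Fin m × Fin n
  ; Adj = λ u v →
      (proj₂ u ≡ proj₂ v × StarAdj m (proj₁ u) (proj₁ v))
      ⊎ (proj₁ u ≡ proj₁ v × PathAdj n (proj₂ u) (proj₂ v)) }

EqOrAdj : (G : Graph) → V G → V G → Set
EqOrAdj G x y = (x ≡ y) ⊎ Adj G x y

-- An induced matching: a list of edges (pairs of adjacent vertices) such
-- that for any two different positions i ≠ j, no endpoint of edge i equals
-- or is adjacent to an endpoint of edge j.  (Hence edges are distinct,
-- pairwise vertex-disjoint, and no graph edge joins two of them.)
IsInducedMatching : (G : Graph) → List (V G × V G) → Set
IsInducedMatching G M =
  ((i : Fin (length M)) → Adj G (proj₁ (lookup M i)) (proj₂ (lookup M i)))
  × ((i j : Fin (length M)) → ¬ (i ≡ j) →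
       (x : V G) → (x ≡ proj₁ (lookup M i) ⊎ x ≡ proj₂ (lookup M i)) →
       (y : V G) → (y ≡ proj₁ (lookup M j) ⊎ y ≡ proj₂ (lookup M j)) →
       ¬ EqOrAdj G x y)

IsInducedMatchingNumber : (G : Graph) → ℕ → Set
IsInducedMatchingNumber G k =
  Σ (List (V G × V G)) (λ M → IsInducedMatching G M × length M ≡ k)
  × ((M : List (V G × V G)) → IsInducedMatching G M → length M Data.Nat.≤ k)

-- The m − 1 leaf rungs (ℓ,1)(ℓ,2) form an induced matching: distinct leaves lie in different
-- columns and are not adjacent in the star.  Conversely, an edge inside the centre column
-- dominates the whole graph, so it can only occur in a matching of size 1; otherwise every
-- edge of an induced matching meets a leaf column, and since each leaf column is a clique,
-- no two edges meet the same one.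
module Submission where

open import Defs
open import Data.Nat using (ℕ; zero; suc; _≤_; _∸_; z≤n; s≤s)
open import Data.Nat.Properties using (≤-trans)
open import Data.Fin using (Fin; zero; suc; cast)
open import Data.Fin.Properties using (injective⇒≤; cast-involutive; _≟_)
open import Data.Product using (_×_; _,_; proj₁; proj₂; Σ; ∃)
open import Data.Sum using (_⊎_; inj₁; inj₂)
open import Data.List using (length; lookup; tabulate)
open import Data.List.Properties using (length-tabulate)
open import Data.Empty using (⊥-elim)
open import Function using (_∘_)
open import Relation.Binary.PropositionalEquality using (_≡_; _≢_; refl; sym; trans; cong; module ≡-Reasoning)
open import Relation.Nullary using (¬_; yes; no)

private variable
  n : ℕ
  A : Set

lookup-tabulate-cast : (f : Fin n → A) (i : Fin (length (tabulate f))) →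
                       lookup (tabulate f) i ≡ f (cast (length-tabulate f) i)
lookup-tabulate-cast {n = suc n} f zero    = refl
lookup-tabulate-cast {n = suc n} f (suc i) = lookup-tabulate-cast (f ∘ suc) i

cast-injective : ∀ {m} .(eq : m ≡ n) {i j : Fin m} → cast eq i ≡ cast eq j → i ≡ j
cast-injective eq {i} {j} e = begin
  i                         ≡⟨ cast-involutive (sym eq) eq i ⟨
  cast (sym eq) (cast eq i) ≡⟨ cong (cast (sym eq)) e ⟩
  cast (sym eq) (cast eq j) ≡⟨ cast-involutive (sym eq) eq j ⟩
  j                         ∎
  where open ≡-Reasoning

all-or-exists : {P Q : Fin n → Set} → (∀ i → P i ⊎ Q i) → (∀ i → P i) ⊎ ∃ Q
all-or-exists {n = zero}  p⊎q = inj₁ λ ()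
all-or-exists {n = suc n} p⊎q with p⊎q zero | all-or-exists (p⊎q ∘ suc)
... | inj₂ q₀ | _            = inj₂ (zero , q₀)
... | inj₁ _  | inj₂ (i , q) = inj₂ (suc i , q)
... | inj₁ p₀ | inj₁ ps      = inj₁ λ { zero → p₀ ; (suc i) → ps i }

module _ (G : Graph) where

  IsEdge : V G × V G → Set
  IsEdge e = Adj G (proj₁ e) (proj₂ e)

  Endpoint : V G × V G → V G → Set
  Endpoint e x = x ≡ proj₁ e ⊎ x ≡ proj₂ e

  Separated : V G × V G → V G × V G → Set
  Separated e e′ = ∀ x → Endpoint e x → ∀ y → Endpoint e′ y → ¬ EqOrAdj G x y

  Touching : V G × V G → V G × V G → Set
  Touching e e′ = Σ (V G) λ x → Σ (V G) λ y → Endpoint e x × Endpoint e′ y × EqOrAdj G x y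

  Dominates : V G × V G → Set
  Dominates e = ∀ y → Σ (V G) λ x → Endpoint e x × EqOrAdj G x y

  tabulate-isInducedMatching : (f : Fin n → V G × V G) → (∀ i → IsEdge (f i)) →
                               (∀ i j → i ≢ j → Separated (f i) (f j)) →
                               IsInducedMatching G (tabulate f)
  tabulate-isInducedMatching f isEdge separated = isEdge′ , separated′
    where
    isEdge′ : ∀ i → IsEdge (lookup (tabulate f) i)
    isEdge′ i rewrite lookup-tabulate-cast f i = isEdge _
    separated′ : ∀ i j → i ≢ j → Separated (lookup (tabulate f) i) (lookup (tabulate f) j)
    separated′ i j i≢j rewrite lookup-tabulate-cast f i | lookup-tabulate-cast f j =
      separated _ _ (i≢j ∘ cast-injective (length-tabulate f))

  dominating⇒length≤1 : ∀ {M} → IsInducedMatching G M → (i : Fin (length M)) →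
                         Dominates (lookup M i) → length M ≤ 1
  dominating⇒length≤1 {M} (_ , separated) i dominates =
    injective⇒≤ {f = λ _ → zero} λ {j} {j′} _ → trans (sym (≡i j)) (≡i j′)
    where
    ≡i : ∀ j → i ≡ j
    ≡i j with i ≟ j
    ... | yes i≡j = i≡j
    ... | no  i≢j with dominates (proj₁ (lookup M j))
    ...   | x , endpoint , x~y = ⊥-elim (separated i j i≢j x endpoint _ (inj₁ refl) x~y)

  touching-labels⇒length≤ : ∀ {M} → IsInducedMatching G M → (label : Fin (length M) → Fin n) →
                            (∀ i j → label i ≡ label j → Touching (lookup M i) (lookup M j)) →
                            length M ≤ n
  touching-labels⇒length≤ (_ , separated) label touching =
    injective⇒≤ {f = label} λ {i} {j} same → injective i j same
    where
    injective : ∀ i j → label i ≡ label j → i ≡ j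
    injective i j same with i ≟ j
    ... | yes i≡j = i≡j
    ... | no  i≢j with touching i j same
    ...   | x , y , endpoint , endpoint′ , x~y =
      ⊥-elim (separated i j i≢j x endpoint y endpoint′ x~y)

module _ (k : ℕ) where

  private
    Book : Graph
    Book = StackedBook (suc (suc k)) 2

    Vertex : Set
    Vertex = V Book

  leafRung : Fin (suc k) → Vertex × Vertex
  leafRung c = (suc c , zero) , (suc c , suc zero)

  leafRung-isEdge : ∀ c → IsEdge Book (leafRung c)
  leafRung-isEdge c = inj₂ (refl , inj₁ refl)

  leafVertices-eqOrAdj⇒≡ : ∀ {c d a b} → EqOrAdj Book (suc c , a) (suc d , b) → c ≡ d
  leafVertices-eqOrAdj⇒≡ (inj₁ refl)                       = refl
  leafVertices-eqOrAdj⇒≡ (inj₂ (inj₁ (_ , inj₁ (() , _))))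
  leafVertices-eqOrAdj⇒≡ (inj₂ (inj₁ (_ , inj₂ (_ , ()))))
  leafVertices-eqOrAdj⇒≡ (inj₂ (inj₂ (refl , _)))          = refl

  leafRungs-separated : ∀ c d → c ≢ d → Separated Book (leafRung c) (leafRung d)
  leafRungs-separated c d c≢d _ (inj₁ refl) _ (inj₁ refl) = c≢d ∘ leafVertices-eqOrAdj⇒≡
  leafRungs-separated c d c≢d _ (inj₁ refl) _ (inj₂ refl) = c≢d ∘ leafVertices-eqOrAdj⇒≡
  leafRungs-separated c d c≢d _ (inj₂ refl) _ (inj₁ refl) = c≢d ∘ leafVertices-eqOrAdj⇒≡
  leafRungs-separated c d c≢d _ (inj₂ refl) _ (inj₂ refl) = c≢d ∘ leafVertices-eqOrAdj⇒≡

  leafRungs-isInducedMatching : IsInducedMatching Book (tabulate leafRung)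
  leafRungs-isInducedMatching =
    tabulate-isInducedMatching Book leafRung leafRung-isEdge leafRungs-separated

  TouchesLeafColumn : Vertex × Vertex → Set
  TouchesLeafColumn e = Σ (Fin (suc k)) λ c → Σ (Fin 2) λ l → Endpoint Book e (suc c , l)

  InCentreColumn : Vertex × Vertex → Set
  InCentreColumn e = proj₁ (proj₁ e) ≡ zero × proj₁ (proj₂ e) ≡ zero

  touchesLeafColumn-or-inCentreColumn : ∀ e → TouchesLeafColumn e ⊎ InCentreColumn e
  touchesLeafColumn-or-inCentreColumn ((suc c , a) , _)          = inj₁ (c , a , inj₁ refl)
  touchesLeafColumn-or-inCentreColumn ((zero , _) , (suc c , b)) = inj₁ (c , b , inj₂ refl)
  touchesLeafColumn-or-inCentreColumn ((zero , _) , (zero , _))  = inj₂ (refl , refl)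

  leafColumn-eqOrAdj : ∀ c a b → EqOrAdj Book (suc c , a) (suc c , b)
  leafColumn-eqOrAdj c zero       zero       = inj₁ refl
  leafColumn-eqOrAdj c (suc zero) (suc zero) = inj₁ refl
  leafColumn-eqOrAdj c zero       (suc zero) = inj₂ (inj₂ (refl , inj₁ refl))
  leafColumn-eqOrAdj c (suc zero) zero       = inj₂ (inj₂ (refl , inj₂ refl))

  sameLeafColumn⇒touching : ∀ {e e′} (t : TouchesLeafColumn e) (t′ : TouchesLeafColumn e′) →
                             proj₁ t ≡ proj₁ t′ → Touching Book e e′
  sameLeafColumn⇒touching (c , a , endpoint) (.c , b , endpoint′) refl =
    _ , _ , endpoint , endpoint′ , leafColumn-eqOrAdj c a b

  centreVertex-eqOrAdj : ∀ c l → EqOrAdj Book (zero , l) (c , l)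
  centreVertex-eqOrAdj zero    l = inj₁ refl
  centreVertex-eqOrAdj (suc c) l = inj₂ (inj₁ (refl , inj₁ (refl , λ ())))

  pathAdj-covers : ∀ {a b} → PathAdj 2 a b → ∀ l → l ≡ a ⊎ l ≡ b
  pathAdj-covers {zero}     {suc zero} _ zero       = inj₁ refl
  pathAdj-covers {zero}     {suc zero} _ (suc zero) = inj₂ refl
  pathAdj-covers {suc zero} {zero}     _ zero       = inj₂ refl
  pathAdj-covers {suc zero} {zero}     _ (suc zero) = inj₁ refl
  pathAdj-covers {zero}     {zero}     (inj₁ ())
  pathAdj-covers {zero}     {zero}     (inj₂ ())
  pathAdj-covers {suc zero} {suc zero} (inj₁ ())
  pathAdj-covers {suc zero} {suc zero} (inj₂ ())

  centreEdge-dominates : ∀ e → IsEdge Book e → InCentreColumn e → Dominates Book e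
  centreEdge-dominates ((zero , _) , (zero , _)) (inj₁ (_ , inj₁ (_ , ≢0))) _ _ = ⊥-elim (≢0 refl)
  centreEdge-dominates ((zero , _) , (zero , _)) (inj₁ (_ , inj₂ (≢0 , _))) _ _ = ⊥-elim (≢0 refl)
  centreEdge-dominates ((zero , _) , (zero , _)) (inj₂ (_ , a~b)) _ (c , l) =
    (zero , l) , endpoint (pathAdj-covers a~b l) , centreVertex-eqOrAdj c l
    where
    endpoint : ∀ {a b} → l ≡ a ⊎ l ≡ b → Endpoint Book ((zero , a) , (zero , b)) (zero , l)
    endpoint (inj₁ refl) = inj₁ refl
    endpoint (inj₂ refl) = inj₂ refl

  inducedMatching-length≤ : ∀ M → IsInducedMatching Book M → length M ≤ suc k
  inducedMatching-length≤ M im@(isEdge , _)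
    with all-or-exists (touchesLeafColumn-or-inCentreColumn ∘ lookup M)
  ... | inj₂ (i , central) =
    ≤-trans (dominating⇒length≤1 Book {M = M} im i (centreEdge-dominates _ (isEdge i) central))
            (s≤s z≤n)
  ... | inj₁ touches =
    touching-labels⇒length≤ Book {M = M} im (proj₁ ∘ touches)
      (λ i j → sameLeafColumn⇒touching (touches i) (touches j))

theorem5 : (m : ℕ) → 2 ≤ m → IsInducedMatchingNumber (StackedBook m 2) (m ∸ 1)
theorem5 (suc (suc k)) (s≤s (s≤s z≤n)) =
  (tabulate (leafRung k) , leafRungs-isInducedMatching k , length-tabulate (leafRung k)) ,
  inducedMatching-length≤ k
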